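{- Let $B$ be a Boolean algebra. Then the cubic algebra $\mathsf I(B)$ (with $B$ regarded as an implication algebra) is isomorphic to the interval algebra of $B$.
   Context: A Boolean algebra $B$ is an implication algebra with $x\to y=\neg x\vee y$. For an implication algebra $\mathcal I$, $\mathsf I(\mathcal I)=\{\langle a,b\rangle : a,b\in\mathcal I,\ a\vee b=\mathbf 1,\ a\wedge b\text{ exists}\}$, ordered componentwise, with join $\langle a,b\rangle\vee\langle c,d\rangle=\langle a\vee c,b\vee d\rangle$, top $\langle\mathbf 1,\mathbf 1\rangle$, and for $\langle c,d\rangle\le\langle a,b\rangle$, $\Delta(\langle a,b\rangle,\langle c,d\rangle)=\langle a\wedge(b\to d),b\wedge(a\to c)\rangle$. The interval algebra of $B$ is $\{[a,b]: a\le b\text{ in }B\}$ ordered by inclusion, with top $[0,1]$, join $[a,b]\vee[c,d]=[a\wedge c,b\vee d]$ and $\Delta([a,b],[c,d])=[a\vee(b\wedge\neg d),\,b\wedge(a\vee\neg c)]$. Isomorphism means a bijection preserving order, joins, top and $\Delta$. -}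

module Defs where

open import Level using (_⊔_)
open import Data.Product using (_×_; _,_; proj₁; proj₂)
open import Algebra.Lattice.Bundles using (BooleanAlgebra)

-- Elements of I(B) and of the interval algebra are
-- represented as pairs of elements of B satisfying a membership predicate;
-- all equalities are componentwise ≈.
module _ {c ℓ} (B : BooleanAlgebra c ℓ) where
  open BooleanAlgebra B

  Pair : Set c
  Pair = Carrier × Carrier

  _≤B_ : Carrier → Carrier → Set ℓ
  x ≤B y = x ∧ y ≈ x

  _⇒_ : Carrier → Carrier → Carrier
  x ⇒ y = ¬ x ∨ y

  _≈P_ : Pair → Pair → Set ℓ
  (a , b) ≈P (a' , b') = (a ≈ a') × (b ≈ b')

  -- The cubic algebra I(B): pairs ⟨a,b⟩ with a ∨ b = 1
  -- (a ∧ b always exists in a Boolean algebra)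
  InI : Pair → Set ℓ
  InI (a , b) = a ∨ b ≈ ⊤

  _≤I_ : Pair → Pair → Set ℓ
  (a , b) ≤I (c' , d) = (a ≤B c') × (b ≤B d)

  _∨I_ : Pair → Pair → Pair
  (a , b) ∨I (c' , d) = (a ∨ c') , (b ∨ d)

  ⊤I : Pair
  ⊤I = ⊤ , ⊤

  ΔI : Pair → Pair → Pair
  ΔI (a , b) (c' , d) = (a ∧ (b ⇒ d)) , (b ∧ (a ⇒ c'))

  -- The interval algebra: [a,b] with a ≤ b, ordered by inclusion
  InInt : Pair → Set ℓ
  InInt (a , b) = a ≤B b

  _⊆Int_ : Pair → Pair → Set ℓ
  (a , b) ⊆Int (c' , d) = (c' ≤B a) × (b ≤B d)

  _∨Int_ : Pair → Pair → Pair
  (a , b) ∨Int (c' , d) = (a ∧ c') , (b ∨ d)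

  ⊤Int : Pair
  ⊤Int = ⊥ , ⊤

  ΔInt : Pair → Pair → Pair
  ΔInt (a , b) (c' , d) = (a ∨ (b ∧ ¬ d)) , (b ∧ (a ∨ ¬ c'))

  record IsIntervalIso (f g : Pair → Pair) : Set (c ⊔ ℓ) where
    field
      f-cong    : ∀ x y → InI x → InI y → x ≈P y → f x ≈P f y
      g-cong    : ∀ x y → InInt x → InInt y → x ≈P y → g x ≈P g y
      f-into    : ∀ x → InI x → InInt (f x)
      g-into    : ∀ y → InInt y → InI (g y)
      g∘f       : ∀ x → InI x → g (f x) ≈P x
      f∘g       : ∀ y → InInt y → f (g y) ≈P y
      f-mono    : ∀ x y → InI x → InI y → x ≤I y → f x ⊆Int f y
      f-reflect : ∀ x y → InI x → InI y → f x ⊆Int f y → x ≤I y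
      f-join    : ∀ x y → InI x → InI y → f (x ∨I y) ≈P (f x ∨Int f y)
      f-top     : f ⊤I ≈P ⊤Int
      f-Δ       : ∀ x y → InI x → InI y → y ≤I x →
                  f (ΔI x y) ≈P ΔInt (f x) (f y)

module Submission where

-- Over a Boolean algebra B the map
--     φ ⟨a , b⟩ = [¬ a , b]
-- is an isomorphism from the cubic algebra I(B) onto the interval algebra
-- of B, and it is its own inverse (¬ is an involution).  Everything reduces
-- to three standard facts about complementation:
--   * x ≤ y  iff  x → y = ¬ x ∨ y = 1; with a := ¬ a this identifies the
--     condition a ∨ b = 1 defining I(B) with ¬ a ≤ b defining intervals;
--   * ¬ is an order anti-automorphism, so φ turns the componentwise order of
--     I(B) into inclusion of intervals, whose first component is reversed;
--   * De Morgan: ¬ (a ∨ c) = ¬ a ∧ ¬ c gives preservation of joins, and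
--     ¬ (a ∧ (b → d)) = ¬ a ∨ (b ∧ ¬ d) gives preservation of Δ.

open import Defs
open import Data.Product using (Σ; _,_)
open import Algebra.Lattice.Bundles using (BooleanAlgebra)
import Algebra.Lattice.Properties.BooleanAlgebra as BooleanAlgebraProperties
import Relation.Binary.Reasoning.Setoid as SetoidReasoning

module IntervalIso {c ℓ} (B : BooleanAlgebra c ℓ) where
  open BooleanAlgebra B
  open BooleanAlgebraProperties B using (∨-zeroˡ; ∧-identityʳ; ∨-identityʳ;
    ¬⊤≈⊥; ¬-involutive; deMorgan₁; deMorgan₂)
  open SetoidReasoning setoid

  infix 4 _≤_
  _≤_ : Carrier → Carrier → Set ℓ
  _≤_ = _≤B_ B

  ≤⇒∨-absorbs : ∀ {x y} → x ≤ y → y ∨ x ≈ y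
  ≤⇒∨-absorbs {x} {y} x≤y = begin
    y ∨ x        ≈⟨ ∨-congˡ (sym x≤y) ⟩
    y ∨ (x ∧ y)  ≈⟨ ∨-congˡ (∧-comm x y) ⟩
    y ∨ (y ∧ x)  ≈⟨ ∨-absorbs-∧ y x ⟩
    y            ∎

  ≤⇒implication-⊤ : ∀ {x y} → x ≤ y → ¬ x ∨ y ≈ ⊤
  ≤⇒implication-⊤ {x} {y} x≤y = begin
    ¬ x ∨ y        ≈⟨ ∨-congˡ (sym (≤⇒∨-absorbs x≤y)) ⟩
    ¬ x ∨ (y ∨ x)  ≈⟨ ∨-congˡ (∨-comm y x) ⟩
    ¬ x ∨ (x ∨ y)  ≈⟨ sym (∨-assoc (¬ x) x y) ⟩
    (¬ x ∨ x) ∨ y  ≈⟨ ∨-congʳ (∨-complementˡ x) ⟩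
    ⊤ ∨ y          ≈⟨ ∨-zeroˡ y ⟩
    ⊤              ∎

  implication-⊤⇒≤ : ∀ {x y} → ¬ x ∨ y ≈ ⊤ → x ≤ y
  implication-⊤⇒≤ {x} {y} x→y≈⊤ = begin
    x ∧ y                ≈⟨ sym (∨-identityʳ (x ∧ y)) ⟩
    (x ∧ y) ∨ ⊥          ≈⟨ ∨-congˡ (sym (∧-complementʳ x)) ⟩
    (x ∧ y) ∨ (x ∧ ¬ x)  ≈⟨ sym (∧-distribˡ-∨ x y (¬ x)) ⟩
    x ∧ (y ∨ ¬ x)        ≈⟨ ∧-congˡ (∨-comm y (¬ x)) ⟩
    x ∧ (¬ x ∨ y)        ≈⟨ ∧-congˡ x→y≈⊤ ⟩
    x ∧ ⊤                ≈⟨ ∧-identityʳ x ⟩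
    x                    ∎

  ¬-antitone : ∀ {x y} → x ≤ y → ¬ y ≤ ¬ x
  ¬-antitone {x} {y} x≤y = begin
    ¬ y ∧ ¬ x  ≈⟨ sym (deMorgan₂ y x) ⟩
    ¬ (y ∨ x)  ≈⟨ ¬-cong (≤⇒∨-absorbs x≤y) ⟩
    ¬ y        ∎

  ¬-reflects-≤ : ∀ {x y} → ¬ y ≤ ¬ x → x ≤ y
  ¬-reflects-≤ {x} {y} ¬y≤¬x = begin
    x ∧ y          ≈⟨ sym (∧-cong (¬-involutive x) (¬-involutive y)) ⟩
    ¬ ¬ x ∧ ¬ ¬ y  ≈⟨ ¬-antitone ¬y≤¬x ⟩
    ¬ ¬ x          ≈⟨ ¬-involutive x ⟩
    x              ∎

  cover⇒¬≤ : ∀ {a b} → a ∨ b ≈ ⊤ → ¬ a ≤ b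
  cover⇒¬≤ {a} {b} a∨b≈⊤ =
    implication-⊤⇒≤ (trans (∨-congʳ (¬-involutive a)) a∨b≈⊤)

  ¬-Δ-lower : ∀ a b d → ¬ (a ∧ (¬ b ∨ d)) ≈ ¬ a ∨ (b ∧ ¬ d)
  ¬-Δ-lower a b d = begin
    ¬ (a ∧ (¬ b ∨ d))    ≈⟨ deMorgan₁ a (¬ b ∨ d) ⟩
    ¬ a ∨ ¬ (¬ b ∨ d)    ≈⟨ ∨-congˡ (deMorgan₂ (¬ b) d) ⟩
    ¬ a ∨ (¬ ¬ b ∧ ¬ d)  ≈⟨ ∨-congˡ (∧-congʳ (¬-involutive b)) ⟩
    ¬ a ∨ (b ∧ ¬ d)      ∎

  φ : Pair B → Pair B
  φ (a , b) = ¬ a , b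

  φ-isIntervalIso : IsIntervalIso B φ φ
  φ-isIntervalIso = record
    { f-cong    = λ { _ _ _ _ (a≈a' , b≈b') → ¬-cong a≈a' , b≈b' }
    ; g-cong    = λ { _ _ _ _ (a≈a' , b≈b') → ¬-cong a≈a' , b≈b' }
    ; f-into    = λ { _ a∨b≈⊤ → cover⇒¬≤ a∨b≈⊤ }
    ; g-into    = λ { _ a≤b → ≤⇒implication-⊤ a≤b }
    ; g∘f       = λ { (a , _) _ → ¬-involutive a , refl }
    ; f∘g       = λ { (a , _) _ → ¬-involutive a , refl }
    ; f-mono    = λ { _ _ _ _ (a≤c , b≤d) → ¬-antitone a≤c , b≤d }
    ; f-reflect = λ { _ _ _ _ (¬c≤¬a , b≤d) → ¬-reflects-≤ ¬c≤¬a , b≤d }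
    ; f-join    = λ { (a , _) (c' , _) _ _ → deMorgan₂ a c' , refl }
    ; f-top     = ¬⊤≈⊥ , refl
    ; f-Δ       = λ { (a , b) (c' , d) _ _ _ →
                        ¬-Δ-lower a b d
                      , ∧-congˡ (∨-congˡ (sym (¬-involutive c'))) }
    }

lemma3p1 : ∀ {c ℓ} (B : BooleanAlgebra c ℓ) →
    Σ (Pair B → Pair B) (λ f → Σ (Pair B → Pair B) (λ g → IsIntervalIso B f g))
lemma3p1 B = IntervalIso.φ B , IntervalIso.φ B , IntervalIso.φ-isIntervalIso B
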